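{- Let $P$ be a polyomino of minimum size among polyominoes containing at least $8$ instances of the L tromino, and let $P$ have width $w$ and height $h$. Then $\max(w,h)\ge 4$ and $|P|\ge 12$.
   Context: Cells are the unit squares of the square lattice, indexed by integer coordinates $(x,y)$. A polyomino is a finite nonempty edge-connected set of cells; its size $|P|$ is its number of cells; its width (resp. height) is the number of columns (resp. rows) occupied by its cells. The L tromino is $\{(0,0),(1,0),(0,1)\}$; an instance is a translate of it, and an instance in $P$ is one contained in $P$. -}

module Defs where

open import Data.Nat using (ℕ; _+_)
open import Data.Integer as ℤ using (ℤ; +_; ∣_∣; _-_)
open import Data.Product using (_×_; _,_; proj₁; proj₂)
open import Data.Product.Properties using (≡-dec)
open import Data.List using (List; []; _∷_; length; map; filter; deduplicate)
open import Data.List.Relation.Unary.All using (All; all?)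
open import Data.List.Relation.Unary.Unique.Propositional using (Unique)
open import Data.List.Membership.Propositional using (_∈_)
import Data.List.Membership.DecPropositional as DecMem
open import Relation.Binary.PropositionalEquality using (_≡_; _≢_)
open import Relation.Binary.Construct.Closure.ReflexiveTransitive using (Star)
open import Relation.Binary using (DecidableEquality)
open import Relation.Nullary using (Dec)

Cell : Set
Cell = ℤ × ℤ

_≟c_ : DecidableEquality Cell
_≟c_ = ≡-dec ℤ._≟_ ℤ._≟_

open DecMem _≟c_ using (_∈?_)

Adjacent : Cell → Cell → Set
Adjacent (x₁ , y₁) (x₂ , y₂) = ∣ x₁ - x₂ ∣ + ∣ y₁ - y₂ ∣ ≡ 1

AdjIn : List Cell → Cell → Cell → Set
AdjIn cs a b = (a ∈ cs) × (b ∈ cs) × Adjacent a b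

record Polyomino : Set where
  field
    cells     : List Cell
    unique    : Unique cells
    nonempty  : cells ≢ []
    connected : ∀ {a b} → a ∈ cells → b ∈ cells → Star (AdjIn cells) a b
open Polyomino public

size : Polyomino → ℕ
size P = length (cells P)

width : Polyomino → ℕ
width P = length (deduplicate ℤ._≟_ (map proj₁ (cells P)))

height : Polyomino → ℕ
height P = length (deduplicate ℤ._≟_ (map proj₂ (cells P)))

Ltromino : List Cell
Ltromino = (+ 0 , + 0) ∷ (+ 1 , + 0) ∷ (+ 0 , + 1) ∷ []

translate : Cell → Cell → Cell
translate (a , b) (x , y) = (a ℤ.+ x , b ℤ.+ y)

InstanceIn : Polyomino → Cell → Set
InstanceIn P v = All (λ c → translate v c ∈ cells P) Ltromino

instanceIn? : (P : Polyomino) → (v : Cell) → Dec (InstanceIn P v)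
instanceIn? P v = all? (λ c → translate v c ∈? cells P) Ltromino

-- Number of instances of the L tromino in P.  Instances are translates by v;
-- since (0,0) ∈ Ltromino, any instance in P has v ∈ P, so it suffices to
-- count the vectors v among the cells of P (each counted once: cells is duplicate-free).
instances : Polyomino → ℕ
instances P = length (filter (instanceIn? P) (cells P))

-- An instance v + {(0,0),(1,0),(0,1)} of the L tromino in P has v, v + (1,0) and v + (0,1)
-- in P.  Hence the rightmost cell of a row is never such a corner v, nor is the topmost cell
-- of a column, so |P| ≥ #instances + max(w,h).  Since also |P| ≤ w h, having w, h ≤ 3 would
-- give 8 + h ≤ |P| ≤ 3 h, i.e. h ≥ 4, which is absurd.
module Submission where

open import Defs
open import Data.Nat using (_≤_; _⊔_)
open import Data.Product using (_×_)

open import Data.Nat using (z≤n; s≤s; _+_; _*_; _≤?_)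
open import Data.Nat.Properties
  using (≤-trans; ≤-reflexive; m≤n⇒m≤1+n; +-suc; +-comm; +-monoʳ-≤; +-monoˡ-≤; +-mono-≤; *-monoˡ-≤;
         +-cancelʳ-≤; *-cancelˡ-≤; ≤⇒≯; ≰⇒>; ≤-pred; m⊔n≤o⇒m≤o; m⊔n≤o⇒n≤o; ⊔-lub; +-distribˡ-⊔;
         module ≤-Reasoning)
open import Data.Integer as ℤ using (ℤ; +_)
import Data.Integer.Properties as ℤ
open import Data.Product using (_,_; proj₁; proj₂; ∃)
open import Data.List using (List; []; _∷_; _++_; length; map; filter; deduplicate; cartesianProduct)
open import Data.List.Properties using (length-++; length-map; filter-notAll)
open import Data.List.Membership.Propositional using (_∈_; _∉_)
open import Data.List.Membership.Propositional.Properties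
  using (∈-map⁺; ∈-map⁻; ∈-filter⁺; ∈-filter⁻; ∈-deduplicate⁺; ∈-deduplicate⁻; ∈-cartesianProduct⁺)
open import Data.List.Membership.DecPropositional using (_∈?_)
open import Data.List.Relation.Binary.Subset.Propositional using (_⊆_)
open import Data.List.Relation.Unary.Any as Any using (here; there)
open import Data.List.Relation.Unary.All as All using (_∷_)
open import Data.List.Relation.Unary.AllPairs using (_∷_)
open import Data.List.Relation.Unary.Unique.Propositional using (Unique)
open import Data.List.Relation.Unary.Unique.DecPropositional.Properties using (deduplicate-!)
open import Data.List.Extrema ℤ.≤-totalOrder using (argmax; argmax-all; f[xs]≤f[argmax])
open import Function using (_∘_)
open import Relation.Binary using (DecidableEquality)
open import Relation.Binary.PropositionalEquality using (_≡_; refl; sym; trans; subst; cong₂; module ≡-Reasoning)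
open import Relation.Nullary using (¬_; yes; no; ¬?; contradiction)
open import Relation.Unary using (Decidable)

module _ {A : Set} where

  unique∧⊆⇒length≤ : DecidableEquality A → {xs ys : List A} →
                     Unique xs → xs ⊆ ys → length xs ≤ length ys
  unique∧⊆⇒length≤ _≟_ {[]} _ _ = z≤n
  unique∧⊆⇒length≤ _≟_ {x ∷ xs} {ys} (x∉xs ∷ !xs) x∷xs⊆ys = begin-strict
    length xs                          ≤⟨ unique∧⊆⇒length≤ _≟_ !xs xs⊆ys-x ⟩
    length (filter (¬? ∘ (x ≟_)) ys)   <⟨ filter-notAll (¬? ∘ (x ≟_)) ys x∈ys ⟩
    length ys                          ∎
    where
    open ≤-Reasoning
    xs⊆ys-x : xs ⊆ filter (¬? ∘ (x ≟_)) ys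
    xs⊆ys-x z∈xs = ∈-filter⁺ (¬? ∘ (x ≟_)) (x∷xs⊆ys (there z∈xs)) (All.lookup x∉xs z∈xs)
    x∈ys = Any.map (λ x≡y x≢y → x≢y x≡y) (x∷xs⊆ys (here refl))

  length-filter-disjoint : {P Q : A → Set} (P? : Decidable P) (Q? : Decidable Q) →
                           (∀ x → P x → ¬ Q x) → ∀ xs →
                           length (filter P? xs) + length (filter Q? xs) ≤ length xs
  length-filter-disjoint P? Q? P⇒¬Q [] = z≤n
  length-filter-disjoint P? Q? P⇒¬Q (x ∷ xs) with P? x | Q? x | length-filter-disjoint P? Q? P⇒¬Q xs
  ... | yes p | yes q | _  = contradiction q (P⇒¬Q x p)
  ... | yes _ | no _  | ih = s≤s ih
  ... | no _  | yes _ | ih = ≤-trans (≤-reflexive (+-suc _ _)) (s≤s ih)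
  ... | no _  | no _  | ih = m≤n⇒m≤1+n ih

length-cartesianProduct : {A B : Set} (xs : List A) (ys : List B) →
                          length (cartesianProduct xs ys) ≡ length xs * length ys
length-cartesianProduct []       ys = refl
length-cartesianProduct (x ∷ xs) ys = begin
  length (map (x ,_) ys ++ cartesianProduct xs ys)        ≡⟨ length-++ (map (x ,_) ys) ⟩
  length (map (x ,_) ys) + length (cartesianProduct xs ys) ≡⟨ cong₂ _+_ (length-map (x ,_) ys) (length-cartesianProduct xs ys) ⟩
  length ys + length xs * length ys                        ∎
  where open ≡-Reasoning

module LineEnds {A B : Set} (_≟A_ : DecidableEquality A) (_≟B_ : DecidableEquality B)
  (next : A → A) (line : A → B) (pos : A → ℤ)
  (line-next : ∀ a → line (next a) ≡ line a) (pos<pos-next : ∀ a → pos a ℤ.< pos (next a))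
  (xs : List A) where

  IsEnd : A → Set
  IsEnd a = next a ∉ xs

  isEnd? : Decidable IsEnd
  isEnd? a = ¬? (_∈?_ _≟A_ (next a) xs)

  ends : List A
  ends = filter isEnd? xs

  end-of-line : ∀ {a} → a ∈ xs → ∃ λ e → e ∈ xs × line e ≡ line a × IsEnd e
  end-of-line {a} a∈xs = e , proj₁ e-on-line , proj₂ e-on-line , next[e]∉xs
    where
    on-line? : Decidable (λ b → line b ≡ line a)
    on-line? b = line b ≟B line a
    same-line : List A
    same-line = filter on-line? xs
    e : A
    e = argmax pos a same-line
    e-on-line : e ∈ xs × line e ≡ line a
    e-on-line = argmax-all pos (a∈xs , refl) (All.tabulate (∈-filter⁻ on-line?))
    next[e]∉xs : IsEnd e
    next[e]∉xs next[e]∈xs = ℤ.≤⇒≯ (All.lookup (f[xs]≤f[argmax] {f = pos} a same-line) next[e]∈same-line)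
                                   (pos<pos-next e)
      where next[e]∈same-line = ∈-filter⁺ on-line? next[e]∈xs (trans (line-next e) (proj₂ e-on-line))

  lines≤ends : length (deduplicate _≟B_ (map line xs)) ≤ length ends
  lines≤ends = ≤-trans (unique∧⊆⇒length≤ _≟B_ (deduplicate-! _≟B_ (map line xs)) lines⊆line[ends])
                       (≤-reflexive (length-map line ends))
    where
    lines⊆line[ends] : deduplicate _≟B_ (map line xs) ⊆ map line ends
    lines⊆line[ends] l∈ with ∈-map⁻ line (∈-deduplicate⁻ _≟B_ (map line xs) l∈)
    ... | a , a∈xs , refl with end-of-line a∈xs
    ...   | e , e∈xs , line[e]≡line[a] , e-end =
      subst (_∈ map line ends) line[e]≡line[a] (∈-map⁺ line (∈-filter⁺ isEnd? e∈xs e-end))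

x<x+1 : ∀ x → x ℤ.< x ℤ.+ + 1
x<x+1 x = ℤ.suc[i]≤j⇒i<j (ℤ.≤-reflexive (ℤ.+-comm (+ 1) x))

instances+lines≤size : ∀ P (d : Cell) (line pos : Cell → ℤ) →
  (∀ c → line (translate c d) ≡ line c) → (∀ c → pos c ℤ.< pos (translate c d)) →
  (∀ v → InstanceIn P v → translate v d ∈ cells P) →
  instances P + length (deduplicate ℤ._≟_ (map line (cells P))) ≤ size P
instances+lines≤size P d line pos line-step pos-step corner+d∈P = begin
  instances P + length (deduplicate ℤ._≟_ (map line (cells P)))  ≤⟨ +-monoʳ-≤ (instances P) lines≤ends ⟩
  instances P + length ends                                       ≤⟨ length-filter-disjoint (instanceIn? P) isEnd? corner⇒¬end (cells P) ⟩
  size P                                                          ∎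
  where
  open ≤-Reasoning
  open LineEnds _≟c_ ℤ._≟_ (λ c → translate c d) line pos line-step pos-step (cells P)
  corner⇒¬end : ∀ v → InstanceIn P v → ¬ IsEnd v
  corner⇒¬end v inst d-end = d-end (corner+d∈P v inst)

instances+height≤size : ∀ P → instances P + height P ≤ size P
instances+height≤size P = instances+lines≤size P (+ 1 , + 0) proj₂ proj₁
  (λ c → ℤ.+-identityʳ (proj₂ c)) (λ c → x<x+1 (proj₁ c)) (λ { _ (_ ∷ right∈P ∷ _) → right∈P })

instances+width≤size : ∀ P → instances P + width P ≤ size P
instances+width≤size P = instances+lines≤size P (+ 0 , + 1) proj₁ proj₂
  (λ c → ℤ.+-identityʳ (proj₁ c)) (λ c → x<x+1 (proj₂ c)) (λ { _ (_ ∷ _ ∷ up∈P ∷ _) → up∈P })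

instances+width⊔height≤size : ∀ P → instances P + (width P ⊔ height P) ≤ size P
instances+width⊔height≤size P = subst (_≤ size P) (sym (+-distribˡ-⊔ (instances P) (width P) (height P)))
  (⊔-lub (instances+width≤size P) (instances+height≤size P))

size≤width*height : ∀ P → size P ≤ width P * height P
size≤width*height P = begin
  size P                        ≤⟨ unique∧⊆⇒length≤ _≟c_ (unique P) cells⊆columns×rows ⟩
  length (cartesianProduct columns rows) ≡⟨ length-cartesianProduct columns rows ⟩
  width P * height P            ∎
  where
  open ≤-Reasoning
  columns rows : List ℤ
  columns = deduplicate ℤ._≟_ (map proj₁ (cells P))
  rows    = deduplicate ℤ._≟_ (map proj₂ (cells P))
  cells⊆columns×rows : cells P ⊆ cartesianProduct columns rows
  cells⊆columns×rows c∈P =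
    ∈-cartesianProduct⁺ (∈-deduplicate⁺ ℤ._≟_ (∈-map⁺ proj₁ c∈P)) (∈-deduplicate⁺ ℤ._≟_ (∈-map⁺ proj₂ c∈P))

w≤3∧8+h≤w*h⇒4≤h : ∀ {w h} → w ≤ 3 → 8 + h ≤ w * h → 4 ≤ h
w≤3∧8+h≤w*h⇒4≤h {w} {h} w≤3 8+h≤wh = *-cancelˡ-≤ 2 (+-cancelʳ-≤ h 8 (2 * h) (begin
  8 + h      ≤⟨ 8+h≤wh ⟩
  w * h      ≤⟨ *-monoˡ-≤ h w≤3 ⟩
  h + 2 * h  ≡⟨ +-comm h (2 * h) ⟩
  2 * h + h  ∎))
  where open ≤-Reasoning

4≤width⊔height : ∀ P → 8 ≤ instances P → 4 ≤ width P ⊔ height P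
4≤width⊔height P 8≤inst with 4 ≤? width P ⊔ height P
... | yes 4≤w⊔h = 4≤w⊔h
... | no 4≰w⊔h = contradiction (w≤3∧8+h≤w*h⇒4≤h w≤3 8+h≤wh) (≤⇒≯ h≤3)
  where
  open ≤-Reasoning
  w⊔h≤3 = ≤-pred (≰⇒> 4≰w⊔h)
  w≤3 = m⊔n≤o⇒m≤o (width P) (height P) w⊔h≤3
  h≤3 = m⊔n≤o⇒n≤o (width P) (height P) w⊔h≤3
  8+h≤wh : 8 + height P ≤ width P * height P
  8+h≤wh = begin
    8 + height P             ≤⟨ +-monoˡ-≤ (height P) 8≤inst ⟩
    instances P + height P   ≤⟨ instances+height≤size P ⟩
    size P                   ≤⟨ size≤width*height P ⟩
    width P * height P       ∎

lemma7p3 : (P : Polyomino) → 8 ≤ instances P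
    → (∀ (Q : Polyomino) → 8 ≤ instances Q → size P ≤ size Q)
    → (4 ≤ width P ⊔ height P) × (12 ≤ size P)
lemma7p3 P 8≤inst _ = 4≤w⊔h , (begin
  12                                  ≤⟨ +-mono-≤ 8≤inst 4≤w⊔h ⟩
  instances P + (width P ⊔ height P)  ≤⟨ instances+width⊔height≤size P ⟩
  size P                              ∎)
  where
  open ≤-Reasoning
  4≤w⊔h = 4≤width⊔height P 8≤inst
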